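{- Let $G$ be a bipartite graph with parts $A$ and $B$ ($A\ne\emptyset$) which is not complete bipartite, i.e. some vertex of $A$ is non-adjacent to some vertex of $B$. Let $u_B$ be the number of vertices of $B$ adjacent to all vertices of $A$, and let $\delta_A$ be the minimum degree of the vertices in $A$. Then $$\mathrm{box}(G)\ge\frac{|B|-u_B}{2(|B|-\delta_A)}.$$
   Context: The boxicity $\mathrm{box}(G)$ is the minimum $k$ such that there are interval graphs $I_1,\dots,I_k$ on $V(G)$ with $E(G)=E(I_1)\cap\cdots\cap E(I_k)$. -}

module Defs where

open import Data.Nat using (ℕ; zero; suc; _+_; _≤_; _⊓_)
open import Data.Bool using (Bool; true; false; if_then_else_; T; _∧_)
open import Data.Fin using (Fin; zero; suc)
open import Data.Sum using (_⊎_; inj₁; inj₂)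
open import Data.Product using (Σ; _×_)
open import Data.Empty using (⊥)
open import Function using (_∘_)
open import Function.Bundles using (_⇔_)
open import Relation.Binary.PropositionalEquality using (_≢_)

count : ∀ {n} → (Fin n → Bool) → ℕ
count {zero}  f = 0
count {suc n} f = (if f zero then 1 else 0) + count (f ∘ suc)

allFin : ∀ {n} → (Fin n → Bool) → Bool
allFin {zero}  f = true
allFin {suc n} f = f zero ∧ allFin (f ∘ suc)

minOver : ∀ {n} → (Fin (suc n) → ℕ) → ℕ
minOver {zero}  f = f zero
minOver {suc n} f = f zero ⊓ minOver (f ∘ suc)

record Interval : Set where
  field
    lo hi : ℕ
    lo≤hi : lo ≤ hi
open Interval public

Meets : Interval → Interval → Set
Meets I J = (lo I ≤ hi J) × (lo J ≤ hi I)

-- An interval graph on V is given by an interval model V → Interval: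
-- distinct u, v are adjacent iff their intervals meet.
IntervalModel : Set → Set
IntervalModel V = V → Interval

-- E(G) = E(I_1) ∩ ... ∩ E(I_k) for interval graphs I_1..I_k on V
-- (edges = pairs of distinct vertices, E given as adjacency relation)
BoxRep : (V : Set) → (V → V → Set) → ℕ → Set
BoxRep V E k =
  Σ (Fin k → IntervalModel V) λ I →
    ∀ u v → u ≢ v → (E u v ⇔ (∀ i → Meets (I i u) (I i v)))

-- box(G) ≥ ... is expressed as: every representation with k interval
-- graphs satisfies the bound.

BipAdj : ∀ {a b} → (Fin a → Fin b → Bool) → (Fin a ⊎ Fin b) → (Fin a ⊎ Fin b) → Set
BipAdj adj (inj₁ x) (inj₂ y) = T (adj x y)
BipAdj adj (inj₂ y) (inj₁ x) = T (adj x y)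
BipAdj adj (inj₁ _) (inj₁ _) = ⊥
BipAdj adj (inj₂ _) (inj₂ _) = ⊥

degA : ∀ {a b} → (Fin a → Fin b → Bool) → Fin a → ℕ
degA adj x = count (adj x)

uB : ∀ {a b} → (Fin a → Fin b → Bool) → ℕ
uB adj = count (λ y → allFin (λ x → adj x y))

δA : ∀ {a b} → (Fin (suc a) → Fin b → Bool) → ℕ
δA adj = minOver (degA adj)

{-# OPTIONS --safe #-}
module Submission where

-- In each interval model I_i let L_i be the vertex of A whose interval ends first and
-- R_i the one whose interval starts last.  If y ∈ B misses some x ∈ A in I_i, then the
-- interval of y lies left of that of x, hence left of R_i's, or right of it, hence
-- right of L_i's; so y is a non-neighbour of L_i or R_i.  Thus the at most 2k vertices
-- L_i, R_i cover all |B| − u_B non-universal vertices of B by their non-neighbourhoods,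
-- each of size at most |B| − δ_A.

open import Defs
open import Data.Nat using (ℕ; zero; suc; _+_; _*_; _∸_; _≤_; _≥_; z≤n; s≤s; _≤?_)
open import Data.Nat.Properties
open import Data.Fin using (Fin; zero; suc)
open import Data.Fin.Properties using (¬Fin0; ¬∀⟶∃¬)
open import Data.Sum using (_⊎_; inj₁; inj₂; [_,_]′)
import Data.Sum as Sum
open import Data.Bool using (Bool; true; false; not; T; _∧_; _∨_)
open import Data.Bool.Properties using (T-∧; T-∨)
open import Data.Product using (∃; ∃₂; _,_; proj₁; proj₂)
open import Data.Empty using (⊥-elim)
open import Data.Unit using (tt)
open import Function using (_∘_; id)
open import Function.Bundles using (_⇔_; Equivalence)
open import Relation.Nullary using (¬_; Dec; yes; no)
open import Relation.Nullary.Decidable using (_×-dec_)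
open import Relation.Binary using (Rel; Transitive; Total)
open import Relation.Binary.PropositionalEquality using (_≡_; _≢_; refl; cong; trans; sym; subst)

T-not⇒¬T : ∀ {b} → T (not b) → ¬ T b
T-not⇒¬T {false} _ ()

¬T⇒T-not : ∀ {b} → ¬ T b → T (not b)
¬T⇒T-not {false} _ = tt
¬T⇒T-not {true} ¬t = ¬t tt

count-complement : ∀ {n} (f : Fin n → Bool) → count f + count (not ∘ f) ≡ n
count-complement {zero} f = refl
count-complement {suc n} f with f zero
... | true  = cong suc (count-complement (f ∘ suc))
... | false = trans (+-suc _ _) (cong suc (count-complement (f ∘ suc)))

count-not : ∀ {n} (f : Fin n → Bool) → count (not ∘ f) ≡ n ∸ count f
count-not {n} f = begin
  count (not ∘ f)                     ≡⟨ sym (m+n∸m≡n (count f) _) ⟩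
  count f + count (not ∘ f) ∸ count f ≡⟨ cong (_∸ count f) (count-complement f) ⟩
  n ∸ count f                         ∎
  where open Relation.Binary.PropositionalEquality.≡-Reasoning

count-false : ∀ n → count {n} (λ _ → false) ≡ 0
count-false zero    = refl
count-false (suc n) = count-false n

count-mono : ∀ {n} (f g : Fin n → Bool) → (∀ i → T (f i) → T (g i)) → count f ≤ count g
count-mono {zero} f g f⊆g = z≤n
count-mono {suc n} f g f⊆g with f zero | g zero | f⊆g zero
... | true  | true  | _   = s≤s (count-mono (f ∘ suc) (g ∘ suc) (f⊆g ∘ suc))
... | true  | false | f⊈g = ⊥-elim (f⊈g tt)
... | false | true  | _   = m≤n⇒m≤1+n (count-mono (f ∘ suc) (g ∘ suc) (f⊆g ∘ suc))
... | false | false | _   = count-mono (f ∘ suc) (g ∘ suc) (f⊆g ∘ suc)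

count-∨ : ∀ {n} (f g : Fin n → Bool) → count (λ i → f i ∨ g i) ≤ count f + count g
count-∨ {zero} f g = z≤n
count-∨ {suc n} f g with f zero | g zero
... | true  | true  = s≤s (≤-trans (count-∨ (f ∘ suc) (g ∘ suc))
                                   (+-monoʳ-≤ (count (f ∘ suc)) (n≤1+n _)))
... | true  | false = s≤s (count-∨ (f ∘ suc) (g ∘ suc))
... | false | true  = ≤-trans (s≤s (count-∨ (f ∘ suc) (g ∘ suc))) (≤-reflexive (sym (+-suc _ _)))
... | false | false = count-∨ (f ∘ suc) (g ∘ suc)

union-bound : ∀ {n} k (f : Fin n → Bool) (g : Fin k → Fin n → Bool) {c} →
  (∀ y → T (f y) → ∃ λ i → T (g i y)) → (∀ i → count (g i) ≤ c) → count f ≤ k * c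
union-bound {n} zero f g cover _ = begin
  count f                  ≤⟨ count-mono f (λ _ → false) (λ y fy → ¬Fin0 (proj₁ (cover y fy))) ⟩
  count {n} (λ _ → false)  ≡⟨ count-false n ⟩
  0                        ∎
  where open ≤-Reasoning
union-bound {n} (suc k) f g {c} cover g≤c = begin
  count f                               ≤⟨ count-mono f _ (λ y → split (f y) (g zero y)) ⟩
  count (λ y → g zero y ∨ rest y)       ≤⟨ count-∨ (g zero) rest ⟩
  count (g zero) + count rest
    ≤⟨ +-mono-≤ (g≤c zero) (union-bound k rest (g ∘ suc) cover′ (g≤c ∘ suc)) ⟩
  c + k * c                             ∎
  where
  open ≤-Reasoning
  rest : Fin n → Bool
  rest y = f y ∧ not (g zero y)

  split : ∀ a b → T a → T (b ∨ (a ∧ not b))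
  split true true  _ = tt
  split true false _ = tt

  cover′ : ∀ y → T (rest y) → ∃ λ i → T (g (suc i) y)
  cover′ y r with Equivalence.to T-∧ r
  ... | fy , ¬g₀y with cover y fy
  ...   | zero  , g₀y = ⊥-elim (T-not⇒¬T ¬g₀y g₀y)
  ...   | suc i , gᵢy = i , gᵢy

minOver-≤ : ∀ {n} (f : Fin (suc n) → ℕ) i → minOver f ≤ f i
minOver-≤ {zero}  f zero    = ≤-refl
minOver-≤ {suc n} f zero    = m⊓n≤m _ _
minOver-≤ {suc n} f (suc i) = ≤-trans (m⊓n≤n _ _) (minOver-≤ (f ∘ suc) i)

allFin-counterexample : ∀ {n} (f : Fin n → Bool) → T (not (allFin f)) → ∃ λ i → T (not (f i))
allFin-counterexample {suc n} f t with f zero in f₀≡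
... | false = zero , subst (T ∘ not) (sym f₀≡) tt
... | true with allFin-counterexample (f ∘ suc) t
...   | i , fi = suc i , fi

attains-minimum : ∀ {ℓ} {A : Set} {_≼_ : Rel A ℓ} → Transitive _≼_ → Total _≼_ →
  ∀ {n} (h : Fin (suc n) → A) → ∃ λ m → ∀ i → h m ≼ h i
attains-minimum ≼-trans ≼-total {zero} h =
  zero , λ { zero → [ id , id ]′ (≼-total (h zero) (h zero)) }
attains-minimum ≼-trans ≼-total {suc n} h with attains-minimum ≼-trans ≼-total (h ∘ suc)
... | m , min-m with ≼-total (h zero) (h (suc m))
...   | inj₁ h₀≼ = zero , λ { zero → [ id , id ]′ (≼-total (h zero) (h zero))
                            ; (suc i) → ≼-trans h₀≼ (min-m i) }
...   | inj₂ ≼h₀ = suc m , λ { zero → ≼h₀ ; (suc i) → min-m i }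

meets? : ∀ I J → Dec (Meets I J)
meets? I J = (lo I ≤? hi J) ×-dec (lo J ≤? hi I)

¬Meets-earlier-or-later : ∀ {J K L R} → ¬ Meets J K →
  hi L ≤ hi J → lo J ≤ lo R → ¬ Meets L K ⊎ ¬ Meets R K
¬Meets-earlier-or-later {J} {K} J∤K hiL≤hiJ loJ≤loR with lo J ≤? hi K
... | yes loJ≤hiK = inj₁ λ (_ , loK≤hiL) → J∤K (loJ≤hiK , ≤-trans loK≤hiL hiL≤hiJ)
... | no  loJ≰hiK = inj₂ λ (loR≤hiK , _) → loJ≰hiK (≤-trans loJ≤loR loR≤hiK)

count-nonNeighbours : ∀ {a b} (adj : Fin (suc a) → Fin b → Bool) x →
  count (not ∘ adj x) ≤ b ∸ δA adj
count-nonNeighbours {b = b} adj x = begin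
  count (not ∘ adj x) ≡⟨ count-not (adj x) ⟩
  b ∸ degA adj x      ≤⟨ ∸-monoʳ-≤ b (minOver-≤ (degA adj) x) ⟩
  b ∸ δA adj          ∎
  where open ≤-Reasoning

module _ {a b k} (adj : Fin (suc a) → Fin b → Bool)
         (I : Fin k → IntervalModel (Fin (suc a) ⊎ Fin b))
         (rep : ∀ u v → u ≢ v → (BipAdj adj u v ⇔ (∀ i → Meets (I i u) (I i v)))) where

  A-interval : Fin k → Fin (suc a) → Interval
  A-interval i x = I i (inj₁ x)

  earliestEnd : ∀ i → ∃ λ L → ∀ x → hi (A-interval i L) ≤ hi (A-interval i x)
  earliestEnd i = attains-minimum ≤-trans ≤-total (hi ∘ A-interval i)

  latestStart : ∀ i → ∃ λ R → ∀ x → lo (A-interval i x) ≤ lo (A-interval i R)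
  latestStart i = attains-minimum {_≼_ = _≥_} (λ p q → ≤-trans q p) (λ m n → ≤-total n m)
                                  (lo ∘ A-interval i)

  endsFirst startsLast : Fin k → Fin (suc a)
  endsFirst  = proj₁ ∘ earliestEnd
  startsLast = proj₁ ∘ latestStart

  separated⇒nonadjacent : ∀ i x y → ¬ Meets (A-interval i x) (I i (inj₂ y)) → T (not (adj x y))
  separated⇒nonadjacent i x y x∤y =
    ¬T⇒T-not λ x~y → x∤y (Equivalence.to (rep (inj₁ x) (inj₂ y) λ ()) x~y i)

  nonadjacent⇒separated : ∀ x y → T (not (adj x y)) →
    ∃ λ i → ¬ Meets (A-interval i x) (I i (inj₂ y))
  nonadjacent⇒separated x y x≁y = ¬∀⟶∃¬ k _ (λ i → meets? (A-interval i x) (I i (inj₂ y)))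
    λ meetEverywhere → T-not⇒¬T x≁y (Equivalence.from (rep (inj₁ x) (inj₂ y) λ ()) meetEverywhere)

  missesExtremes : Fin k → Fin b → Bool
  missesExtremes i y = not (adj (endsFirst i) y) ∨ not (adj (startsLast i) y)

  nonUniversal⇒missesExtremes : ∀ y → T (not (allFin (λ x → adj x y))) →
    ∃ λ i → T (missesExtremes i y)
  nonUniversal⇒missesExtremes y nonUniversal
    with allFin-counterexample (λ x → adj x y) nonUniversal
  ... | x , x≁y with nonadjacent⇒separated x y x≁y
  ...   | i , x∤y = i , Equivalence.from T-∨
          (Sum.map (separated⇒nonadjacent i _ y) (separated⇒nonadjacent i _ y)
                   (¬Meets-earlier-or-later {A-interval i x} {I i (inj₂ y)}
                                            {A-interval i (endsFirst i)} {A-interval i (startsLast i)}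
                                            x∤y (proj₂ (earliestEnd i) x) (proj₂ (latestStart i) x)))

  count-missesExtremes : ∀ i → count (missesExtremes i) ≤ 2 * (b ∸ δA adj)
  count-missesExtremes i = begin
    count (missesExtremes i)
      ≤⟨ count-∨ (not ∘ adj (endsFirst i)) (not ∘ adj (startsLast i)) ⟩
    count (not ∘ adj (endsFirst i)) + count (not ∘ adj (startsLast i))
      ≤⟨ +-mono-≤ (count-nonNeighbours adj _) (count-nonNeighbours adj _) ⟩
    c + c                ≡⟨ cong (c +_) (sym (+-identityʳ c)) ⟩
    2 * c                ∎
    where
    open ≤-Reasoning
    c : ℕ
    c = b ∸ δA adj

-- The non-completeness hypothesis only makes the paper's denominator positive; the
-- bound with the denominator cleared holds without it.
theorem10 : (a b : ℕ) (adj : Fin (suc a) → Fin b → Bool) →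
    (∃₂ λ x y → adj x y ≡ false) →
    (k : ℕ) → BoxRep (Fin (suc a) ⊎ Fin b) (BipAdj adj) k →
    b ∸ uB adj ≤ 2 * k * (b ∸ δA adj)
theorem10 a b adj _ k (I , rep) = begin
  b ∸ uB adj            ≡⟨ sym (count-not universal) ⟩
  count (not ∘ universal)
    ≤⟨ union-bound k _ (missesExtremes adj I rep) (nonUniversal⇒missesExtremes adj I rep)
                       (count-missesExtremes adj I rep) ⟩
  k * (2 * c)           ≡⟨ sym (trans (cong (_* c) (*-comm 2 k)) (*-assoc k 2 c)) ⟩
  2 * k * c             ∎
  where
  open ≤-Reasoning
  universal : Fin b → Bool
  universal y = allFin (λ x → adj x y)
  c : ℕ
  c = b ∸ δA adj
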